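{- Let $m,s \in \mathbb N$. There exists $t_0$ such that for every $t\ge t_0$ the following holds. Let $H$ be a 3-graph and let $G \subseteq \partial H$ with $G\cong K_{t,t}$, and suppose $G$ has an $m$-multicoloring. Then there exists a subgraph $F\subseteq G$ with $F\cong K_{s,s}$ such that either $F$ has a rainbow list-edge-coloring, or $F$ has an $m$-multicoloring $\chi_1,\dots,\chi_m$ whose colorings are pairwise disjoint and each of which is monochromatic or canonical (with respect to the bipartition of $F$).
   Context: A 3-graph $H$ is a family of 3-element subsets of a finite vertex set; $\partial H$ is the graph of pairs contained in some edge of $H$. For a pair $S$, $N_H(S)=\{x: S\cup\{x\}\in H\}$. For a graph $G\subseteq\partial H$ and $e\in G$, the list of $e$ is $L_G(e)=N_H(e)\setminus V(G)$ (its elements are called colors), and $L_G=\bigcup_{e\in G}L_G(e)$. A list-edge-coloring of $G$ is a map $\chi:G\to L_G$ with $\chi(e)\in L_G(e)$ for all $e\in G$; it is rainbow if injective. Two list-edge-colorings $\chi_1,\chi_2$ are disjoint if $\chi_1(e)\ne\chi_2(f)$ for all $e,f\in G$. An $m$-multicoloring of $G$ is a family of list-edge-colorings $\chi_1,\dots,\chi_m$ of $G$ with $\chi_i(e)\ne\chi_j(e)$ for every $e\in G$ and $i\ne j$. For a bipartite graph with parts $X,Y$, an edge-coloring is monochromatic if all edges have the same color; it is $X$-canonical if for each $x\in X$ all edges at $x$ have the same color and edges at different vertices of $X$ have different colors; it is canonical if it is $X$-canonical or $Y$-canonical. -}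

module Defs where

open import Data.Nat using (ℕ)
open import Data.Fin using (Fin)
open import Data.Bool using (Bool; true)
open import Data.Product using (Σ; ∃; _×_)
open import Data.Sum using (_⊎_)
open import Relation.Binary.PropositionalEquality using (_≡_; _≢_)

-- A 3-graph on the finite vertex set Fin n: a family of 3-element subsets,
-- encoded by its (symmetric) indicator on ordered triples of distinct vertices.
record ThreeGraph (n : ℕ) : Set where
  field
    edge     : Fin n → Fin n → Fin n → Bool
    sym₁₂    : ∀ x y z → edge x y z ≡ edge y x z
    sym₂₃    : ∀ x y z → edge x y z ≡ edge x z y
    distinct : ∀ x y z → edge x y z ≡ true → (x ≢ y) × (y ≢ z) × (x ≢ z)
open ThreeGraph public

-- A complete bipartite graph K_{k,k} in the vertex set Fin n is given by
-- X Y : Fin k → Fin n (its two parts); its edges are the pairs {X i, Y j}.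
-- The vertex set V(G) is the union of the images of X and Y.

InNbhd : ∀ {n} → ThreeGraph n → Fin n → Fin n → Fin n → Set
InNbhd H u v x = edge H u v x ≡ true

InShadow : ∀ {n k} → ThreeGraph n → (X Y : Fin k → Fin n) → Set
InShadow H X Y = ∀ i j → ∃ λ x → InNbhd H (X i) (Y j) x

InList : ∀ {n k} → ThreeGraph n → (X Y : Fin k → Fin n) → Fin k → Fin k → Fin n → Set
InList H X Y i j c = InNbhd H (X i) (Y j) c × (∀ l → c ≢ X l) × (∀ l → c ≢ Y l)

IsListColoring : ∀ {n k} → ThreeGraph n → (X Y : Fin k → Fin n) → (Fin k → Fin k → Fin n) → Set
IsListColoring H X Y χ = ∀ i j → InList H X Y i j (χ i j)

IsRainbow : ∀ {n k} → (Fin k → Fin k → Fin n) → Set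
IsRainbow χ = ∀ i j i' j' → χ i j ≡ χ i' j' → (i ≡ i') × (j ≡ j')

IsMulticoloring : ∀ {n k} → ThreeGraph n → (X Y : Fin k → Fin n) → (m : ℕ) →
                  (Fin m → Fin k → Fin k → Fin n) → Set
IsMulticoloring H X Y m χ =
  (∀ r → IsListColoring H X Y (χ r)) ×
  (∀ r r' i j → r ≢ r' → χ r i j ≢ χ r' i j)

Disjoint : ∀ {n k} → (Fin k → Fin k → Fin n) → (Fin k → Fin k → Fin n) → Set
Disjoint χ₁ χ₂ = ∀ i j i' j' → χ₁ i j ≢ χ₂ i' j'

Monochromatic : ∀ {n k} → (Fin k → Fin k → Fin n) → Set
Monochromatic χ = ∀ i j i' j' → χ i j ≡ χ i' j'

-- X-canonical (first index = vertex of X)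
XCanonical : ∀ {n k} → (Fin k → Fin k → Fin n) → Set
XCanonical χ = (∀ i j j' → χ i j ≡ χ i j') × (∀ i i' j j' → i ≢ i' → χ i j ≢ χ i' j')

-- Y-canonical (second index = vertex of Y)
YCanonical : ∀ {n k} → (Fin k → Fin k → Fin n) → Set
YCanonical χ = (∀ i i' j → χ i j ≡ χ i' j) × (∀ i i' j j' → j ≢ j' → χ i j ≢ χ i' j')

Canonical : ∀ {n k} → (Fin k → Fin k → Fin n) → Set
Canonical χ = XCanonical χ ⊎ YCanonical χ

-- The edge {a i, b j} is the cell (i , j) of a t × t grid, a colouring is a map
-- Fin t → Fin t → Fin n, and a copy of K_{s,s} is a block of s distinct rows
-- and s distinct columns.  All relevant properties (list-colouring, rainbow,
-- monochromatic, canonical, disjoint) survive restriction to a sub-block, so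
-- the goals are met one at a time on smaller and smaller blocks.
module Submission where

open import Defs
open import Data.Nat using (ℕ; zero; suc; _+_; _*_; _≤_; s≤s)
open import Data.Nat.Properties
  using (≤-refl; ≤-trans; m≤m+n; m≤n+m; n≤1+n; n<1+n; +-suc; m≤m*n; *-comm; +-monoʳ-≤)
open import Data.Nat.GeneralisedArithmetic using (fold)
open import Data.Fin using (Fin; zero; suc; inject≤; lift; combine; _≟_)
open import Data.Fin.Properties
  using (inject≤-injective; lift-injective; suc-injective; any?; pigeonhole; <⇒≢; combine-injective)
open import Data.Product using (Σ; ∃; _×_; _,_; proj₁; proj₂)
open import Data.Sum using (_⊎_; inj₁; inj₂; [_,_])
import Data.Sum as Sum
open import Data.Unit using (⊤; tt)
open import Data.Empty using (⊥-elim)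
open import Data.List using (List; []; _∷_; length; allFin; cartesianProduct)
open import Data.List.Relation.Unary.All as All using (All; []; _∷_)
open import Data.List.Membership.Propositional.Properties using (∈-allFin; ∈-cartesianProduct⁺)
open import Function using (_∘_; id; case_of_)
open import Function.Definitions using (Injective)
import Function.Construct.Composition as Composition
open import Relation.Nullary using (¬_; Dec; yes; no; contradiction)
open import Relation.Nullary.Decidable using (toSum; _⊎-dec_)
open import Relation.Binary.PropositionalEquality using (_≡_; _≢_; refl; sym; trans; cong; subst)

Inj : ∀ {k N} → (Fin k → Fin N) → Set
Inj f = Injective _≡_ _≡_ f

∘-inj : ∀ {a b c} {g : Fin b → Fin c} {f : Fin a → Fin b} → Inj g → Inj f → Inj (g ∘ f)
∘-inj g-inj f-inj = Composition.injective _≡_ _≡_ _≡_ f-inj g-inj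

prefix : ∀ {k N} → k ≤ N → Fin k → Fin N
prefix k≤N i = inject≤ i k≤N

prefix-inj : ∀ {k N} (k≤N : k ≤ N) → Inj (prefix k≤N)
prefix-inj k≤N {i} {j} = inject≤-injective k≤N k≤N i j

empty-inj : ∀ {N} {f : Fin 0 → Fin N} → Inj f
empty-inj {x = ()}

lift-inj : ∀ {k N} {f : Fin k → Fin N} → Inj f → Inj (lift 1 f)
lift-inj {f = f} f-inj = lift-injective f f-inj 1

Sub : ∀ {N} → (Fin N → Set) → ℕ → Set
Sub {N} P k = Σ (Fin k → Fin N) λ e → Inj e × (∀ i → P (e i))

none : ∀ {N} {P : Fin N → Set} → Sub P 0
none = (λ ()) , empty-inj , λ ()

cons : ∀ {N k} {P : Fin (suc N) → Set} → P zero → Sub (P ∘ suc) k → Sub P (suc k)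
cons p₀ (e , e-inj , pe) = lift 1 e , lift-inj e-inj , λ { zero → p₀ ; (suc i) → pe i }

shift : ∀ {N k} {P : Fin (suc N) → Set} → Sub (P ∘ suc) k → Sub P k
shift (e , e-inj , pe) = suc ∘ e , ∘-inj suc-injective e-inj , pe

cover-pigeonhole : ∀ {N} A B {P Q : Fin N → Set} → A + B ≤ suc N →
                   (∀ x → P x ⊎ Q x) → Sub P A ⊎ Sub Q B
cover-pigeonhole zero B {P} le cover = inj₁ (none {P = P})
cover-pigeonhole (suc A) zero {Q = Q} le cover = inj₂ (none {P = Q})
cover-pigeonhole {zero} (suc A) (suc B) (s≤s le) cover =
  contradiction (≤-trans (m≤n+m (suc B) A) le) λ ()
cover-pigeonhole {suc N} (suc A) (suc B) {P} {Q} (s≤s le) cover with cover zero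
... | inj₁ p₀ = Sum.map (cons {P = P} p₀) (shift {P = Q})
                  (cover-pigeonhole A (suc B) {P ∘ suc} {Q ∘ suc} le (cover ∘ suc))
... | inj₂ q₀ = Sum.map (shift {P = P}) (cons {P = Q} q₀)
                  (cover-pigeonhole (suc A) B {P ∘ suc} {Q ∘ suc}
                     (subst (_≤ suc N) (+-suc A B) le) (cover ∘ suc))

-- The elements of B carry pairwise distinct labels from Fin D, so B has at
-- most D elements.
record Labelled {M} (D : ℕ) (B : Fin M → Set) : Set where
  field
    label     : ∀ {y} → B y → Fin D
    label-inj : ∀ {y y'} (b : B y) (b' : B y') → label b ≡ label b' → y ≡ y'
open Labelled

labelled-∘ : ∀ {M M' D} {B : Fin M → Set} {g : Fin M' → Fin M} →
             Inj g → Labelled D B → Labelled D (B ∘ g)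
labelled-∘ g-inj L = record
  { label = label L ; label-inj = λ b b' same → g-inj (label-inj L b b' same) }

avoid : ∀ {M} D k {B : Fin M → Set} → D + k ≤ M →
        (∀ y → Dec (B y)) → Labelled D B → Sub (λ y → ¬ B y) k
avoid D k {B} le B? L with cover-pigeonhole (suc D) k (s≤s le) (toSum ∘ B?)
... | inj₂ outside = outside
... | inj₁ (e , e-inj , inside) with pigeonhole (n<1+n D) (λ i → label L (inside i))
...   | i , j , i<j , same = ⊥-elim (<⇒≢ i<j (e-inj (label-inj L _ _ same)))

Independent : ∀ {k M} → (Fin M → Fin M → Set) → (Fin k → Fin M) → Set
Independent C p = ∀ i i' → i ≢ i' → ¬ C (p i) (p i')

-- A decidable symmetric relation in which the neighbours of each vertex carry
-- distinct labels from Fin D has an independent set of size k among k (D + 1)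
-- vertices: keep zero, discard its at most D neighbours, and recurse.
independent-set : ∀ D k {M} (C : Fin M → Fin M → Set) → (∀ x y → Dec (C x y)) →
                  (∀ {x y} → C x y → C y x) → (∀ x → Labelled D (C x)) →
                  k * suc D ≤ M → Σ (Fin k → Fin M) λ p → Inj p × Independent C p
independent-set D zero C C? C-sym L le = (λ ()) , empty-inj , λ ()
independent-set D (suc k) {suc M} C C? C-sym L (s≤s le) =
  let q , q-inj , far = avoid D (k * suc D) {C zero ∘ suc} le (C? zero ∘ suc)
                          (labelled-∘ suc-injective (L zero))
      g = suc ∘ q
      g-inj = ∘-inj suc-injective q-inj
      p , p-inj , indep = independent-set D k (λ x y → C (g x) (g y)) (λ x y → C? (g x) (g y))
                            C-sym (λ x → labelled-∘ g-inj (L (g x))) ≤-refl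
  in lift 1 (q ∘ p) , lift-inj (∘-inj q-inj p-inj) , λ where
       zero    zero     ne → ⊥-elim (ne refl)
       zero    (suc j)  _  → far (p j)
       (suc j) zero     _  → far (p j) ∘ C-sym
       (suc j) (suc j') ne → indep j j' (ne ∘ cong suc)

Constant : ∀ {k n} → (Fin k → Fin n) → Set
Constant g = ∀ i j → g i ≡ g j

ConstOrInj : ∀ {k n} → (Fin k → Fin n) → Set
ConstOrInj g = Constant g ⊎ Inj g

On : ∀ {M n} → (∀ {k} → (Fin k → Fin n) → Set) → ℕ → (Fin M → Fin n) → Set
On {M} Φ k f = Σ (Fin k → Fin M) λ p → Inj p × Φ (f ∘ p)

on-∘ : ∀ {M M' n k} {Φ : ∀ {k} → (Fin k → Fin n) → Set} {f : Fin M → Fin n}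
       {e : Fin M' → Fin M} → Inj e → On Φ k (f ∘ e) → On Φ k f
on-∘ e-inj (p , p-inj , φ) = _ , ∘-inj e-inj p-inj , φ

constOrInj-∘ : ∀ {k k' n} {g : Fin k → Fin n} {p : Fin k' → Fin k} →
               Inj p → ConstOrInj g → ConstOrInj (g ∘ p)
constOrInj-∘ {p = p} p-inj (inj₁ const) = inj₁ λ i j → const (p i) (p j)
constOrInj-∘ p-inj (inj₂ g-inj) = inj₂ (∘-inj g-inj p-inj)

constant-fibre : ∀ {M n k} {f : Fin M → Fin n} {v : Fin n} →
                 Sub (λ x → f x ≡ v) k → On Constant k f
constant-fibre (p , p-inj , at-v) = p , p-inj , λ i j → trans (at-v i) (sym (at-v j))

-- Split off the fibre of f zero: either it is large,
-- or recurse on its complement, where f never takes the value f zero.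
const-or-injective : ∀ {n} a b {M} (f : Fin M → Fin n) → b * a ≤ M →
                     On Constant a f ⊎ On Inj b f
const-or-injective zero b f le = inj₁ ((λ ()) , empty-inj , λ ())
const-or-injective (suc a) zero f le = inj₂ ((λ ()) , empty-inj , empty-inj)
const-or-injective (suc a) (suc b) {suc M} f (s≤s le)
  with cover-pigeonhole a (b * suc a) {λ y → f (suc y) ≡ f zero} {λ y → f (suc y) ≢ f zero}
         (≤-trans le (n≤1+n M)) (λ y → toSum (f (suc y) ≟ f zero))
... | inj₁ fibre = inj₁ (constant-fibre {f = f} (cons {P = λ x → f x ≡ f zero} refl fibre))
... | inj₂ (e , e-inj , differ) with const-or-injective (suc a) b (f ∘ suc ∘ e) ≤-refl
...   | inj₁ const = inj₁ (on-∘ {Φ = Constant} {f = f} (∘-inj suc-injective e-inj) const)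
...   | inj₂ (p , p-inj , fp-inj) = inj₂ (lift 1 (e ∘ p) , lift-inj (∘-inj e-inj p-inj) , f-inj)
  where
  f-inj : Inj (f ∘ lift 1 (e ∘ p))
  f-inj {zero}  {zero}  _  = refl
  f-inj {zero}  {suc j} eq = ⊥-elim (differ (p j) (sym eq))
  f-inj {suc i} {zero}  eq = ⊥-elim (differ (p i) eq)
  f-inj {suc i} {suc j} eq = cong suc (fp-inj eq)

either-on : ∀ {M n k} {f : Fin M → Fin n} → On Constant k f ⊎ On Inj k f → On ConstOrInj k f
either-on (inj₁ (p , p-inj , const)) = p , p-inj , inj₁ const
either-on (inj₂ (p , p-inj , f-inj)) = p , p-inj , inj₂ f-inj

tameBound : ℕ → ℕ → ℕ
tameBound zero    k = k
tameBound (suc a) k = tameBound a (k * k)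

-- Among tameBound a k columns there are k on which each of a rows is constant
-- or injective: tame the other rows on k · k columns, then the first row.
tame-rows : ∀ {n} a k {M} (c : Fin a → Fin M → Fin n) → tameBound a k ≤ M →
            Σ (Fin k → Fin M) λ q → Inj q × ∀ x → ConstOrInj (c x ∘ q)
tame-rows zero k c le = prefix le , prefix-inj le , λ ()
tame-rows (suc a) k c le =
  let q , q-inj , tame = tame-rows a (k * k) (c ∘ suc) le
      p , p-inj , first = either-on {f = c zero ∘ q} (const-or-injective k k (c zero ∘ q) ≤-refl)
  in q ∘ p , ∘-inj q-inj p-inj , λ where
       zero    → first
       (suc x) → constOrInj-∘ p-inj (tame x)

rainbowBound : ℕ → ℕ
rainbowBound k = k * suc (k * k)

-- Two columns clash when they share a colour; a clashing partner of a
-- column is determined by the two rows involved, so an independent set of the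
-- clash relation exists, and on it equal colours force equal cells.
rainbow-columns : ∀ {n} k {M} (c : Fin k → Fin M → Fin n) → (∀ i → Inj (c i)) →
                  (∀ y → Inj (λ i → c i y)) → rainbowBound k ≤ M →
                  Σ (Fin k → Fin M) λ q → Inj q × IsRainbow (λ i j → c i (q j))
rainbow-columns k {M} c row-inj col-inj le =
  let q , q-inj , no-clash = independent-set (k * k) k Clash Clash? clash-sym clash-labelled le
  in q , q-inj , rainbow q no-clash
  where
  Clash : Fin M → Fin M → Set
  Clash y y' = Σ (Fin k) λ i → Σ (Fin k) λ i' → c i y ≡ c i' y'

  Clash? : ∀ y y' → Dec (Clash y y')
  Clash? y y' = any? λ i → any? λ i' → c i y ≟ c i' y'

  clash-sym : ∀ {y y'} → Clash y y' → Clash y' y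
  clash-sym (i , i' , eq) = i' , i , sym eq

  clash-labelled : ∀ y → Labelled (k * k) (Clash y)
  clash-labelled y = record { label = λ (i , i' , _) → combine i i' ; label-inj = same-rows }
    where
    same-rows : ∀ {y₁ y₂} (b : Clash y y₁) (b' : Clash y y₂) →
                combine (proj₁ b) (proj₁ (proj₂ b)) ≡ combine (proj₁ b') (proj₁ (proj₂ b')) → y₁ ≡ y₂
    same-rows (i , i' , e₁) (j , j' , e₂) eq with combine-injective i i' j j' eq
    ... | refl , refl = row-inj i' (trans (sym e₁) e₂)

  rainbow : (q : Fin k → Fin M) → Independent Clash q → IsRainbow (λ i j → c i (q j))
  rainbow q no-clash i j i' j' eq with j ≟ j'
  ... | yes refl = col-inj (q j) eq , refl
  ... | no j≢j' = ⊥-elim (no-clash j j' j≢j' (i , i' , eq))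

record Block (R' C' R C : ℕ) : Set where
  constructor block
  field
    rows     : Fin R' → Fin R
    cols     : Fin C' → Fin C
    rows-inj : Inj rows
    cols-inj : Inj cols
open Block

Subgrid : ℕ → ℕ → ℕ → Set
Subgrid k = Block k k

_↾_ : ∀ {A : Set} {R C R' C'} → (Fin R → Fin C → A) → Block R' C' R C → Fin R' → Fin C' → A
(c ↾ G) i j = c (rows G i) (cols G j)

-- A block of a block is a block; c ↾ (G ⊙ G') is (c ↾ G) ↾ G' by definition.
_⊙_ : ∀ {R C R₁ C₁ R₂ C₂} → Block R₁ C₁ R C → Block R₂ C₂ R₁ C₁ → Block R₂ C₂ R C
G ⊙ G' = block (rows G ∘ rows G') (cols G ∘ cols G')
               (∘-inj (rows-inj G) (rows-inj G')) (∘-inj (cols-inj G) (cols-inj G'))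
infixl 5 _⊙_

leading : ∀ {R' C' R C} → R' ≤ R → C' ≤ C → Block R' C' R C
leading R'≤R C'≤C = block (prefix R'≤R) (prefix C'≤C) (prefix-inj R'≤R) (prefix-inj C'≤C)

row-block : ∀ {R' R C} {e : Fin R' → Fin R} → Inj e → Block R' C R C
row-block {e = e} e-inj = block e id e-inj id

Good : ∀ {k n} → (Fin k → Fin k → Fin n) → Set
Good χ = Monochromatic χ ⊎ Canonical χ

Pattern : ∀ {k n} → (Fin k → Fin k → Fin n) → Set
Pattern χ = IsRainbow χ ⊎ Good χ

colBound rowBound : ℕ → ℕ
colBound k = suc (k + rainbowBound k)
rowBound k = k * k + tameBound (colBound k) k

-- If every row is constant, k rows of equal colours give a monochromatic block
-- and k rows of distinct colours an X-canonical one.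
constant-rows : ∀ {n} k {R C} (e : Fin R → Fin (suc C) → Fin n) → (∀ x → Constant (e x)) →
                k * k ≤ R → k ≤ suc C → Σ (Subgrid k R (suc C)) λ G → Good (e ↾ G)
constant-rows k e const le k≤C with const-or-injective k k (λ x → e x zero) le
... | inj₁ (p , p-inj , same) = block p (prefix k≤C) p-inj (prefix-inj k≤C) , inj₁ mono
  where
  mono : ∀ i j i' j' → e (p i) (prefix k≤C j) ≡ e (p i') (prefix k≤C j')
  mono i j i' j' = trans (const (p i) _ zero) (trans (same i i') (const (p i') zero _))
... | inj₂ (p , p-inj , distinct) =
  block p (prefix k≤C) p-inj (prefix-inj k≤C) , inj₂ (inj₁ (same-in-row , apart))
  where
  same-in-row : ∀ i j j' → e (p i) (prefix k≤C j) ≡ e (p i) (prefix k≤C j')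
  same-in-row i j j' = const (p i) _ _
  apart : ∀ i i' j j' → i ≢ i' → e (p i) (prefix k≤C j) ≢ e (p i') (prefix k≤C j')
  apart i i' j j' i≢i' eq = i≢i' (distinct (trans (const (p i) zero _) (trans eq (const (p i') _ zero))))

-- If every row is injective, pick k rows on which every column is constant or
-- injective.  Then k constant columns give a Y-canonical block, and otherwise
-- rainbowBound k injective columns contain a rainbow block.
injective-rows : ∀ {n} k {R} (e : Fin R → Fin (colBound k) → Fin n) → (∀ x → Inj (e x)) →
                 tameBound (colBound k) k ≤ R → Σ (Subgrid k R (colBound k)) λ G → Pattern (e ↾ G)
injective-rows k e row-inj le
  with tame-rows (colBound k) k (λ y x → e x y) le
... | p , p-inj , tame
  with cover-pigeonhole k (rainbowBound k) (≤-trans (n≤1+n _) (n≤1+n _)) tame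
...   | inj₁ (q , q-inj , const) = block p q p-inj q-inj , inj₂ (inj₂ (inj₂ (same-in-col , apart)))
  where
  same-in-col : ∀ i i' j → e (p i) (q j) ≡ e (p i') (q j)
  same-in-col i i' j = const j i i'
  apart : ∀ i i' j j' → j ≢ j' → e (p i) (q j) ≢ e (p i') (q j')
  apart i i' j j' j≢j' eq = j≢j' (q-inj (row-inj (p i) (trans eq (const j' i' i))))
...   | inj₂ (q , q-inj , col-inj) =
  let q' , q'-inj , rainbow = rainbow-columns k (λ i y → e (p i) (q y))
                                (λ i → ∘-inj (row-inj (p i)) q-inj) col-inj ≤-refl
  in block p (q ∘ q') p-inj (∘-inj q-inj q'-inj) , inj₁ rainbow

tame-block : ∀ {n} a k {R C} (d : Fin R → Fin C → Fin n) → a ≤ R → tameBound a k ≤ C →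
             Σ (Block a k R C) λ B → ∀ x → ConstOrInj ((d ↾ B) x)
tame-block a k d a≤R le =
  let q , q-inj , tame = tame-rows a k (d ∘ prefix a≤R) le
  in block (prefix a≤R) q (prefix-inj a≤R) q-inj , tame

-- Bipartite canonical Ramsey theorem: in a tamed block of rowBound k rows,
-- either k · k rows are constant or tameBound (colBound k) k rows are injective.
canonical-ramsey : ∀ {n} k {R C} (d : Fin R → Fin C → Fin n) →
                   rowBound k ≤ R → tameBound (rowBound k) (colBound k) ≤ C →
                   Σ (Subgrid k R C) λ G → Pattern (d ↾ G)
canonical-ramsey k d rows-le cols-le with tame-block (rowBound k) (colBound k) d rows-le cols-le
... | B , tame with cover-pigeonhole (k * k) (tameBound (colBound k) k) (n≤1+n _) tame
...   | inj₁ (e , e-inj , const) =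
  let G , good = constant-rows k (d ↾ (B ⊙ row-block e-inj)) const ≤-refl (≤-trans (m≤m+n k _) (n≤1+n _))
  in B ⊙ row-block e-inj ⊙ G , inj₂ good
...   | inj₂ (e , e-inj , injective) =
  let G , outcome = injective-rows k (d ↾ (B ⊙ row-block e-inj)) injective ≤-refl
  in B ⊙ row-block e-inj ⊙ G , outcome

Differ : ∀ {R C n} → (Fin R → Fin C → Fin n) → (Fin R → Fin C → Fin n) → Set
Differ c c' = ∀ i j → c i j ≢ c' i j

row-of-colour : ∀ {N n} {c : Fin N → Fin N → Fin n} → XCanonical c →
                ∀ {x y j j'} → c x j ≡ c y j' → x ≡ y
row-of-colour (_ , apart) {x} {y} eq with x ≟ y
... | yes x≡y = x≡y
... | no x≢y = ⊥-elim (apart _ _ _ _ x≢y eq)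

col-of-colour : ∀ {N n} {c : Fin N → Fin N → Fin n} → YCanonical c →
                ∀ {x y j j'} → c x j ≡ c y j' → j ≡ j'
col-of-colour (_ , apart) {j = j} {j'} eq with j ≟ j'
... | yes j≡j' = j≡j'
... | no j≢j' = ⊥-elim (apart _ _ _ _ j≢j' eq)

disjointBound : ℕ → ℕ
disjointBound k = k * 3

k≤disjointBound : ∀ k → k ≤ disjointBound k
k≤disjointBound k = m≤m*n k 3

k+k≤disjointBound : ∀ k → k + k ≤ disjointBound k
k+k≤disjointBound k = subst (k + k ≤_) (*-comm 3 k) (+-monoʳ-≤ k (m≤m+n k _))

-- Two X-canonical colourings: rows x of c and y of c' meet when they share a
-- colour.  Each row meets at most one row in each direction, so the meeting
-- relation has an independent set of k rows, on which c and c' are disjoint.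
disjoin-XX : ∀ {n} k {N} (c c' : Fin N → Fin N → Fin n) → disjointBound k ≤ N →
             XCanonical c → XCanonical c' → Differ c c' →
             Σ (Subgrid k N N) λ G → Disjoint (c ↾ G) (c' ↾ G)
disjoin-XX k {N} c c' le xc xc' differ =
  let p , p-inj , apart = independent-set 2 k Meet Meet? meet-sym meet-labelled le
  in block p Q p-inj (prefix-inj k≤N) , disjoint p apart
  where
  k≤N = ≤-trans (k≤disjointBound k) le
  Q = prefix k≤N

  Shares : Fin N → Fin N → Set
  Shares x y = Σ (Fin N) λ j → Σ (Fin N) λ j' → c x j ≡ c' y j'

  Meet : Fin N → Fin N → Set
  Meet x y = Shares x y ⊎ Shares y x

  Meet? : ∀ x y → Dec (Meet x y)
  Meet? x y = shares? x y ⊎-dec shares? y x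
    where shares? : ∀ x y → Dec (Shares x y)
          shares? x y = any? λ j → any? λ j' → c x j ≟ c' y j'

  meet-sym : ∀ {x y} → Meet x y → Meet y x
  meet-sym = Sum.swap

  meet-labelled : ∀ x → Labelled 2 (Meet x)
  meet-labelled x = record { label = [ (λ _ → zero) , (λ _ → suc zero) ] ; label-inj = same-side }
    where
    same-side : ∀ {y y'} (b : Meet x y) (b' : Meet x y') →
                [ (λ _ → zero) , (λ _ → suc zero) ] b ≡ [ (λ _ → zero) , (λ _ → suc zero) ] b' → y ≡ y'
    same-side (inj₁ (j₁ , j₁' , e₁)) (inj₁ (j₂ , j₂' , e₂)) _ =
      row-of-colour xc' (trans (sym e₁) (trans (proj₁ xc x j₁ j₂) e₂))
    same-side (inj₂ (j₁ , j₁' , e₁)) (inj₂ (j₂ , j₂' , e₂)) _ =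
      row-of-colour xc (trans e₁ (trans (proj₁ xc' x j₁' j₂') (sym e₂)))
    same-side (inj₁ _) (inj₂ _) ()
    same-side (inj₂ _) (inj₁ _) ()

  disjoint : (p : Fin k → Fin N) → Independent Meet p → Disjoint (λ i j → c (p i) (Q j)) (λ i j → c' (p i) (Q j))
  disjoint p apart i j i' j' eq with i ≟ i'
  ... | yes refl = differ (p i) (Q j') (trans (proj₁ xc (p i) (Q j') (Q j)) eq)
  ... | no i≢i' = apart i i' i≢i' (inj₁ (Q j , Q j' , eq))

-- c X-canonical, c' Y-canonical: fix k rows of c; a column of c' meeting their
-- colours is labelled by the row it meets (c' determines the column from the
-- colour), so k + k columns contain k that avoid all those colours.
disjoin-XY : ∀ {n} k {N} (c c' : Fin N → Fin N → Fin n) → disjointBound k ≤ N →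
             XCanonical c → YCanonical c' → Σ (Subgrid k N N) λ G → Disjoint (c ↾ G) (c' ↾ G)
disjoin-XY k {N} c c' le xc yc' =
  let Q , Q-inj , far = avoid k k {Hit} (≤-trans (k+k≤disjointBound k) le) Hit? hit-labelled
  in block P Q (prefix-inj k≤N) Q-inj , λ i j i' j' eq → far j' (i , Q j , P i' , eq)
  where
  k≤N = ≤-trans (k≤disjointBound k) le
  P = prefix k≤N

  Hit : Fin N → Set
  Hit y = Σ (Fin k) λ i → Σ (Fin N) λ x → Σ (Fin N) λ x' → c (P i) x ≡ c' x' y

  Hit? : ∀ y → Dec (Hit y)
  Hit? y = any? λ i → any? λ x → any? λ x' → c (P i) x ≟ c' x' y

  hit-labelled : Labelled k Hit
  hit-labelled = record { label = proj₁ ; label-inj = same-row }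
    where
    same-row : ∀ {y y'} (b : Hit y) (b' : Hit y') → proj₁ b ≡ proj₁ b' → y ≡ y'
    same-row (i , x₁ , x₁' , e₁) (.i , x₂ , x₂' , e₂) refl =
      col-of-colour yc' (trans (sym e₁) (trans (proj₁ xc (P i) x₁ x₂) e₂))

transpose : ∀ {A : Set} {R C} → (Fin R → Fin C → A) → Fin C → Fin R → A
transpose c j i = c i j

transpose-block : ∀ {R' C' R C} → Block R' C' R C → Block C' R' C R
transpose-block G = block (cols G) (rows G) (cols-inj G) (rows-inj G)

Y→X : ∀ {N n} {c : Fin N → Fin N → Fin n} → YCanonical c → XCanonical (transpose c)
Y→X (same , apart) = (λ j i i' → same i i' j) , (λ j j' i i' j≢j' → apart i i' j j' j≢j')

disjoint-sym : ∀ {k n} {c c' : Fin k → Fin k → Fin n} → Disjoint c c' → Disjoint c' c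
disjoint-sym disjoint i j i' j' eq = disjoint i' j' i j (sym eq)

-- A monochromatic one is disjoint from the other on any block; the canonical
-- cases reduce to disjoin-XX and disjoin-XY by symmetry and transposition.
disjoin : ∀ {n} k {N} (c c' : Fin N → Fin N → Fin n) → disjointBound k ≤ N →
          Good c → Good c' → Differ c c' → Σ (Subgrid k N N) λ G → Disjoint (c ↾ G) (c' ↾ G)
disjoin k c c' le (inj₁ mono) _ differ =
  leading k≤N k≤N , λ i j i' j' eq → differ _ _ (trans (mono _ _ _ _) eq)
  where k≤N = ≤-trans (k≤disjointBound k) le
disjoin k c c' le (inj₂ _) (inj₁ mono') differ =
  leading k≤N k≤N , λ i j i' j' eq → differ _ _ (trans eq (mono' _ _ _ _))
  where k≤N = ≤-trans (k≤disjointBound k) le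
disjoin k c c' le (inj₂ (inj₁ xc)) (inj₂ (inj₁ xc')) differ = disjoin-XX k c c' le xc xc' differ
disjoin k c c' le (inj₂ (inj₁ xc)) (inj₂ (inj₂ yc')) differ = disjoin-XY k c c' le xc yc'
disjoin k c c' le (inj₂ (inj₂ yc)) (inj₂ (inj₁ xc')) differ =
  let G , disjoint = disjoin-XY k c' c le xc' yc in G , disjoint-sym disjoint
disjoin k c c' le (inj₂ (inj₂ yc)) (inj₂ (inj₂ yc')) differ =
  let G , disjoint = disjoin-XX k (transpose c) (transpose c') le (Y→X yc) (Y→X yc')
                       (λ j i → differ i j)
  in transpose-block G , λ i j i' j' → disjoint j i j' i'

rainbow-↾ : ∀ {k N n} {c : Fin N → Fin N → Fin n} (G : Subgrid k N N) → IsRainbow c → IsRainbow (c ↾ G)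
rainbow-↾ G rainbow i j i' j' eq =
  let same-row , same-col = rainbow _ _ _ _ eq in rows-inj G same-row , cols-inj G same-col

good-↾ : ∀ {k N n} {c : Fin N → Fin N → Fin n} (G : Subgrid k N N) → Good c → Good (c ↾ G)
good-↾ G (inj₁ mono) = inj₁ λ _ _ _ _ → mono _ _ _ _
good-↾ G (inj₂ (inj₁ (same , apart))) =
  inj₂ (inj₁ ((λ _ _ _ → same _ _ _) , λ _ _ _ _ i≢i' → apart _ _ _ _ (i≢i' ∘ rows-inj G)))
good-↾ G (inj₂ (inj₂ (same , apart))) =
  inj₂ (inj₂ ((λ _ _ _ → same _ _ _) , λ _ _ _ _ j≢j' → apart _ _ _ _ (j≢j' ∘ cols-inj G)))

pattern-↾ : ∀ {k N n} {c : Fin N → Fin N → Fin n} (G : Subgrid k N N) → Pattern c → Pattern (c ↾ G)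
pattern-↾ G = Sum.map (rainbow-↾ G) (good-↾ G)

list-colouring-↾ : ∀ {n k t} {H : ThreeGraph n} {a b : Fin t → Fin n} {χ : Fin t → Fin t → Fin n}
                   (G : Subgrid k t t) → IsListColoring H a b χ →
                   IsListColoring H (a ∘ rows G) (b ∘ cols G) (χ ↾ G)
list-colouring-↾ G colouring i j =
  let in-nbhd , not-a , not-b = colouring (rows G i) (cols G j)
  in in-nbhd , not-a ∘ rows G , not-b ∘ cols G

Family : ℕ → ℕ → ℕ → Set
Family m n k = Fin m → Fin k → Fin k → Fin n

_⇂_ : ∀ {m n k N} → Family m n N → Subgrid k N N → Family m n k
(ψ ⇂ G) r = ψ r ↾ G

-- Each goal g can be achieved on a
-- k × k block of any grid of size bound k carrying the invariant, and goals and
-- invariant survive restriction; then all goals hold on one block, obtained by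
-- achieving the first goal on a large block and recursing inside it.
module Iterate {m n} {Goals : Set}
  (Goal  : Goals → ∀ {k} → Family m n k → Set)
  (goal-⇂ : ∀ g {k N} {ψ : Family m n N} (G : Subgrid k N N) → Goal g ψ → Goal g (ψ ⇂ G))
  (Inv   : ∀ {k} → Family m n k → Set)
  (inv-⇂ : ∀ {k N} {ψ : Family m n N} (G : Subgrid k N N) → Inv ψ → Inv (ψ ⇂ G))
  (bound : ℕ → ℕ)
  (step  : ∀ g k {N} (ψ : Family m n N) → bound k ≤ N → Inv ψ →
           Σ (Subgrid k N N) λ G → Goal g (ψ ⇂ G))
  where

  achieve-all : ∀ (gs : List Goals) k {N} (ψ : Family m n N) → fold k bound (length gs) ≤ N →
                Inv ψ → Σ (Subgrid k N N) λ G → All (λ g → Goal g (ψ ⇂ G)) gs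
  achieve-all [] k ψ le _ = leading le le , []
  achieve-all (g ∷ gs) k ψ le inv =
    let G₁ , goal  = step g (fold k bound (length gs)) ψ le inv
        G₂ , goals = achieve-all gs k (ψ ⇂ G₁) ≤-refl (inv-⇂ G₁ inv)
    in G₁ ⊙ G₂ , goal-⇂ g G₂ goal ∷ goals

-- Enough rows and columns for canonical-ramsey on a square grid.
ramseyBound : ℕ → ℕ
ramseyBound k = rowBound k + tameBound (rowBound k) (colBound k)

canonicalise-all : ∀ {m n} (rs : List (Fin m)) k {N} (ψ : Family m n N) →
                   fold k ramseyBound (length rs) ≤ N →
                   Σ (Subgrid k N N) λ G → All (λ r → Pattern ((ψ ⇂ G) r)) rs
canonicalise-all rs k ψ le = Stage.achieve-all rs k ψ le tt
  where
  module Stage = Iterate (λ r ψ → Pattern (ψ r)) (λ r G → pattern-↾ G) (λ _ → ⊤) (λ _ _ → tt)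
    ramseyBound (λ r k ψ le _ → canonical-ramsey k (ψ r) (≤-trans (m≤m+n _ _) le) (≤-trans (m≤n+m _ _) le))

Distinct : ∀ {m n k} → Family m n k → Set
Distinct ψ = ∀ r r' i j → r ≢ r' → ψ r i j ≢ ψ r' i j

DisjointPair : ∀ {m n k} → Fin m × Fin m → Family m n k → Set
DisjointPair (r , r') ψ = r ≢ r' → Disjoint (ψ r) (ψ r')

disjoin-all : ∀ {m n} (rrs : List (Fin m × Fin m)) k {N} (ψ : Family m n N) →
              fold k disjointBound (length rrs) ≤ N → (∀ r → Good (ψ r)) → Distinct ψ →
              Σ (Subgrid k N N) λ G → All (λ rr → DisjointPair rr (ψ ⇂ G)) rrs
disjoin-all rrs k ψ le good distinct = Stage.achieve-all rrs k ψ le (good , distinct)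
  where
  step : ∀ rr k {N} (ψ : Family _ _ N) → disjointBound k ≤ N → (∀ r → Good (ψ r)) × Distinct ψ →
         Σ (Subgrid k N N) λ G → DisjointPair rr (ψ ⇂ G)
  step (r , r') k ψ le (good , distinct) with r ≟ r'
  ... | yes r≡r' = leading k≤N k≤N , λ r≢r' → ⊥-elim (r≢r' r≡r')
    where k≤N = ≤-trans (k≤disjointBound k) le
  ... | no r≢r' =
    let G , disjoint = disjoin k (ψ r) (ψ r') le (good r) (good r') (λ i j → distinct r r' i j r≢r')
    in G , λ _ → disjoint

  module Stage = Iterate (λ rr ψ → DisjointPair rr ψ) (λ _ G disjoint r≢r' _ _ _ _ → disjoint r≢r' _ _ _ _)
    (λ ψ → (∀ r → Good (ψ r)) × Distinct ψ)
    (λ G (good , distinct) → (λ r → good-↾ G (good r)) , λ r r' i j → distinct r r' _ _)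
    disjointBound step

k≤fold : ∀ (f : ℕ → ℕ) → (∀ k → k ≤ f k) → ∀ k n → k ≤ fold k f n
k≤fold f grows k zero = ≤-refl
k≤fold f grows k (suc n) = ≤-trans (k≤fold f grows k n) (grows _)

some-or-all : ∀ {m} {A B : Fin m → Set} → (∀ r → A r ⊎ B r) → (∃ A) ⊎ (∀ r → B r)
some-or-all {zero} _ = inj₂ λ ()
some-or-all {suc m} {A} {B} ab with ab zero | some-or-all {A = A ∘ suc} {B = B ∘ suc} (ab ∘ suc)
... | inj₁ a | _ = inj₁ (zero , a)
... | inj₂ _ | inj₁ (r , a) = inj₁ (suc r , a)
... | inj₂ b | inj₂ bs = inj₂ λ { zero → b ; (suc r) → bs r }

-- Stage 1 makes each colouring rainbow or good on a block of size K; a rainbow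
-- one finishes the proof, otherwise stage 2 makes the good ones pairwise
-- disjoint on a block of size s.
theorem3p3 : (m s : ℕ) → ∃ λ t₀ → (t : ℕ) → t₀ ≤ t →
    {n : ℕ} (H : ThreeGraph n) (a b : Fin t → Fin n) →
    Injective _≡_ _≡_ a → Injective _≡_ _≡_ b → (∀ i j → a i ≢ b j) →
    InShadow H a b →
    (∃ λ (χ : Fin m → Fin t → Fin t → Fin n) → IsMulticoloring H a b m χ) →
    ∃ λ (p : Fin s → Fin t) → ∃ λ (q : Fin s → Fin t) →
      Injective _≡_ _≡_ p × Injective _≡_ _≡_ q ×
      ((∃ λ (χ : Fin s → Fin s → Fin n) →
          IsListColoring H (a ∘ p) (b ∘ q) χ × IsRainbow χ)
       ⊎
       (∃ λ (χ : Fin m → Fin s → Fin s → Fin n) →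
          IsMulticoloring H (a ∘ p) (b ∘ q) m χ ×
          (∀ r r' → r ≢ r' → Disjoint (χ r) (χ r')) ×
          (∀ r → Monochromatic (χ r) ⊎ Canonical (χ r))))
theorem3p3 m s = t₀ , λ t t₀≤t H a b _ _ _ _ (χ , colourings , distinct) →
  let G₀ = leading t₀≤t t₀≤t
      G₁ , patterns = canonicalise-all (allFin m) K (χ ⇂ G₀) ≤-refl
  in case some-or-all (λ r → All.lookup patterns (∈-allFin r)) of λ where
    (inj₁ (r , rainbow)) →
      let G = G₀ ⊙ G₁ ⊙ leading s≤K s≤K
      in rows G , cols G , (λ {_} {_} → rows-inj G) , (λ {_} {_} → cols-inj G) ,
         inj₁ (χ r ↾ G , list-colouring-↾ {H = H} G (colourings r) , rainbow-↾ (leading s≤K s≤K) rainbow)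
    (inj₂ good) →
      let G₂ , disjoint = disjoin-all pairs s (χ ⇂ (G₀ ⊙ G₁)) ≤-refl good (λ r r' _ _ → distinct r r' _ _)
          G = G₀ ⊙ G₁ ⊙ G₂
      in rows G , cols G , (λ {_} {_} → rows-inj G) , (λ {_} {_} → cols-inj G) ,
         inj₂ (χ ⇂ G , ((λ r → list-colouring-↾ {H = H} G (colourings r)) , (λ r r' _ _ → distinct r r' _ _)) ,
               (λ r r' → All.lookup disjoint (∈-cartesianProduct⁺ (∈-allFin r) (∈-allFin r'))) ,
               (λ r → good-↾ G₂ (good r)))
  where
  pairs = cartesianProduct (allFin m) (allFin m)
  K = fold s disjointBound (length pairs)
  t₀ = fold K ramseyBound (length (allFin m))
  s≤K = k≤fold disjointBound k≤disjointBound s (length pairs)
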